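{- For every natural number $m\geq 1$ there exists an $m$-connected graph $G$ such that $\gamma'_s(G)\leq -\frac{m}{6}|V(G)|$.
   Context: All graphs are finite, simple and undirected. For a vertex $v$, $E(v)$ denotes the set of edges incident with $v$. For an edge $e=uv$, $N[e]$ denotes the set of edges of $G$ sharing at least one endpoint with $e$ (including $e$ itself). For a graph $G$ with at least one edge, a function $f:E(G)\to\{ -1,1\}$ is a signed edge domination function (SEDF) if $\sum_{e'\in N[e]}f(e')\geq 1$ for every $e\in E(G)$. The signed edge domination number is $\gamma'_s(G)=\min\{\sum_{e\in E(G)}f(e) : f \text{ is an SEDF of } G\}$. -}

module Defs where

open import Data.Nat using (ℕ; zero; suc; _<ᵇ_)
open import Data.Fin using (Fin; zero; suc; toℕ)
open import Data.Fin.Subset using (Subset; _∉_; ∣_∣)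
open import Data.Bool using (Bool; true; false; if_then_else_)
open import Data.Integer as ℤ using (ℤ; 0ℤ; 1ℤ; -1ℤ)
open import Data.Product using (Σ; _×_; _,_)
open import Data.Sum using (_⊎_)
open import Relation.Binary.PropositionalEquality using (_≡_)

record Graph (n : ℕ) : Set where
  field
    adj   : Fin n → Fin n → Bool
    sym   : ∀ u v → adj u v ≡ adj v u
    irrefl : ∀ u → adj u u ≡ false
open Graph public

Adj : ∀ {n} → Graph n → Fin n → Fin n → Set
Adj G u v = adj G u v ≡ true

Σℤ : (n : ℕ) → (Fin n → ℤ) → ℤ
Σℤ zero    g = 0ℤ
Σℤ (suc n) g = g zero ℤ.+ Σℤ n (λ i → g (suc i))

onEdge : ∀ {n} → Graph n → Fin n → Fin n → ℤ → ℤ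
onEdge G u v x = if adj G u v then x else 0ℤ

-- An edge labelling: a symmetric function on ordered pairs of vertices
-- (so f(uv) = f(vu) is a function of the unordered edge {u,v});
-- its values on non-adjacent pairs are irrelevant.
Labelling : ℕ → Set
Labelling n = Fin n → Fin n → ℤ

sumAt : ∀ {n} → Graph n → Labelling n → Fin n → ℤ
sumAt {n} G f u = Σℤ n (λ w → onEdge G u w (f u w))

-- Σ_{e' ∈ N[uv]} f(e') = Σ_{E(u)} f + Σ_{E(v)} f − f(uv)
-- (the edge uv lies in both E(u) and E(v), and N[uv] = E(u) ∪ E(v)).
closedSum : ∀ {n} → Graph n → Labelling n → Fin n → Fin n → ℤ
closedSum G f u v = (sumAt G f u ℤ.+ sumAt G f v) ℤ.- f u v

IsSign : ℤ → Set
IsSign x = (x ≡ 1ℤ) ⊎ (x ≡ -1ℤ)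

record IsSEDF {n : ℕ} (G : Graph n) (f : Labelling n) : Set where
  field
    symmetric : ∀ u v → f u v ≡ f v u
    signs     : ∀ u v → Adj G u v → IsSign (f u v)
    dominates : ∀ u v → Adj G u v → 1ℤ ℤ.≤ closedSum G f u v

weight : ∀ {n} → Graph n → Labelling n → ℤ
weight {n} G f =
  Σℤ n (λ u → Σℤ n (λ v → if toℕ u <ᵇ toℕ v then onEdge G u v (f u v) else 0ℤ))

data WalkAvoiding {n : ℕ} (G : Graph n) (S : Subset n) : Fin n → Fin n → Set where
  here : ∀ {u} → u ∉ S → WalkAvoiding G S u u
  step : ∀ {u w v} → u ∉ S → Adj G u w → WalkAvoiding G S w v → WalkAvoiding G S u v

ConnectedAvoiding : ∀ {n} → Graph n → Subset n → Set
ConnectedAvoiding G S = ∀ u v → u ∉ S → v ∉ S → WalkAvoiding G S u v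

-- k-connected (Diestel): |V(G)| > k and G − X is connected for every X ⊆ V(G) with |X| < k.
KConnected : ∀ {n} → ℕ → Graph n → Set
KConnected {n} k G = (k Data.Nat.< n) × (∀ (X : Subset n) → ∣ X ∣ Data.Nat.< k → ConnectedAvoiding G X)
  where import Data.Nat

module Submission where

-- Construction, for m = m′ + 1: a core K_{4m} split into four groups of m
-- vertices; to group t attach c = 3m − 1 pendants, each adjacent to exactly
-- the m core vertices of group t.  Label core–core edges +1, core–pendant
-- edges −1.  Core vertices then have label sum (4m − 1) − c = m and pendants
-- −m, so closed neighbourhoods sum to 2m − 1 (core–core) or 1 (core–pendant):
-- the labelling is an SEDF.  By the handshake identity
-- 2·w(f) = Σ_v (label sum at v) = 4m·m − 4c·m, and 6·w(f) ≤ −m·|V| becomes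
-- 8m² ≥ 8m.  Deleting fewer than m vertices leaves every vertex equal or
-- adjacent to a surviving core vertex, and the core is a clique: G is
-- m-connected.

open import Defs
open import Data.Nat using (ℕ; _≤_; _*_)
open import Data.Integer as ℤ using (ℤ; +_; -_)
open import Data.Product using (Σ; _×_; ∃)

open import Data.Nat as ℕ using (zero; suc; _+_; _∸_; _<_; _<ᵇ_; _≡ᵇ_; z≤n; s≤s; NonZero)
import Data.Nat.Properties as ℕP
open import Data.Nat.DivMod using (_/_; m*n/n≡m; m<n⇒m/n≡0; +-distrib-/-∣ˡ; m<n*o⇒m/o<n)
open import Data.Nat.Divisibility using (divides)
import Data.Nat.Tactic.RingSolver as ℕSolver
open import Data.Integer using (0ℤ; 1ℤ; -1ℤ)
import Data.Integer.Properties as ℤP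
open import Data.Integer.Tactic.RingSolver using (solve-∀)
open import Data.Fin as Fin using (Fin; toℕ)
import Data.Fin.Properties as FinP
open import Data.Fin.Subset using (Subset; _∉_; ∣_∣; inside; outside)
open import Data.Fin.Subset.Properties using (∣p∣≤∣x∷p∣)
open import Data.Vec using (_∷_)
open import Data.Vec.Base using (there)
open import Data.Bool using (Bool; true; false; if_then_else_; not; T)
open import Data.Product using (_,_)
open import Data.Sum using (_⊎_; inj₁; inj₂)
open import Data.Empty using (⊥-elim)
open import Relation.Nullary using (Dec; yes; no)
open import Relation.Binary.Definitions using (tri<; tri≈; tri>)
open import Relation.Binary.PropositionalEquality as ≡
  using (_≡_; _≢_; refl; trans; cong; cong₂; subst; module ≡-Reasoning)
open import Algebra.Properties.CommutativeMonoid.Sum ℤP.+-0-commutativeMonoid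
  using (sum; sum-cong-≗; ∑-distrib-+; ∑-comm)

when : Bool → ℤ → ℤ
when b x = if b then x else 0ℤ

<⇒<ᵇ≡true : ∀ {i k} → i < k → (i <ᵇ k) ≡ true
<⇒<ᵇ≡true {zero}  {suc k} _       = refl
<⇒<ᵇ≡true {suc i} {suc k} (s≤s p) = <⇒<ᵇ≡true p

≥⇒<ᵇ≡false : ∀ {i k} → k ≤ i → (i <ᵇ k) ≡ false
≥⇒<ᵇ≡false {i}     {zero}  _       = refl
≥⇒<ᵇ≡false {suc i} {suc k} (s≤s p) = ≥⇒<ᵇ≡false p

≡ᵇ-refl : ∀ i → (i ≡ᵇ i) ≡ true
≡ᵇ-refl zero    = refl
≡ᵇ-refl (suc i) = ≡ᵇ-refl i

≡ᵇ-sym : ∀ i j → (i ≡ᵇ j) ≡ (j ≡ᵇ i)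
≡ᵇ-sym zero    zero    = refl
≡ᵇ-sym zero    (suc j) = refl
≡ᵇ-sym (suc i) zero    = refl
≡ᵇ-sym (suc i) (suc j) = ≡ᵇ-sym i j

[q*d+r]/d≡q : ∀ q r d .{{_ : NonZero d}} → r < d → (q * d + r) / d ≡ q
[q*d+r]/d≡q q r d r<d = trans (+-distrib-/-∣ˡ r (divides q refl))
  (trans (cong₂ _+_ (m*n/n≡m q d) (m<n⇒m/n≡0 r<d)) (ℕP.+-identityʳ q))

inBlock : ∀ q d i .{{_ : NonZero d}} → q * d ≤ i → i < q * d + d → i / d ≡ q
inBlock q d i lo≤i i<hi = trans (cong (_/ d) i≡) ([q*d+r]/d≡q q (i ∸ q * d) d r<d)
  where
  i≡ : i ≡ q * d + (i ∸ q * d)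
  i≡ = ≡.sym (ℕP.m+[n∸m]≡n lo≤i)
  r<d : i ∸ q * d < d
  r<d = ℕP.+-cancelˡ-< (q * d) _ _ (subst (_< q * d + d) i≡ i<hi)

[q*d+r]<k*d : ∀ {q k r d} → q < k → r < d → q * d + r < k * d
[q*d+r]<k*d {q} {k} {r} {d} q<k r<d = ℕP.≤-trans (ℕP.+-monoʳ-< (q * d) r<d)
  (ℕP.≤-trans (ℕP.≤-reflexive (ℕP.+-comm (q * d) d)) (ℕP.*-monoˡ-≤ d q<k))

Σ< : ℕ → (ℕ → ℤ) → ℤ
Σ< zero    h = 0ℤ
Σ< (suc k) h = h 0 ℤ.+ Σ< k (λ i → h (suc i))

Σ<-cong : ∀ k {h h′ : ℕ → ℤ} → (∀ i → i < k → h i ≡ h′ i) → Σ< k h ≡ Σ< k h′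
Σ<-cong zero    e = refl
Σ<-cong (suc k) e = cong₂ ℤ._+_ (e 0 (s≤s z≤n)) (Σ<-cong k (λ i i<k → e (suc i) (s≤s i<k)))

Σ<-split : ∀ p q h → Σ< (p + q) h ≡ Σ< p h ℤ.+ Σ< q (λ i → h (p + i))
Σ<-split zero    q h = ≡.sym (ℤP.+-identityˡ _)
Σ<-split (suc p) q h = trans (cong (ℤ._+_ (h 0)) (Σ<-split p q (λ i → h (suc i))))
                             (≡.sym (ℤP.+-assoc (h 0) _ _))

Σ<-blocks : ∀ k d h → Σ< (k * d) h ≡ Σ< k (λ q → Σ< d (λ r → h (q * d + r)))
Σ<-blocks zero    d h = refl
Σ<-blocks (suc k) d h = trans (Σ<-split d (k * d) h) (cong (ℤ._+_ (Σ< d h))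
  (trans (Σ<-blocks k d (λ i → h (d + i)))
         (Σ<-cong k (λ q _ → Σ<-cong d (λ r _ → cong h (≡.sym (ℕP.+-assoc d (q * d) r)))))))

Σ<-zero : ∀ k → Σ< k (λ _ → 0ℤ) ≡ 0ℤ
Σ<-zero zero    = refl
Σ<-zero (suc k) = trans (ℤP.+-identityˡ _) (Σ<-zero k)

Σ<-ones : ∀ k → Σ< k (λ _ → 1ℤ) ≡ + k
Σ<-ones zero    = refl
Σ<-ones (suc k) = cong (ℤ._+_ 1ℤ) (Σ<-ones k)

Σ<-const : ∀ k x → Σ< k (λ _ → + x) ≡ + (k * x)
Σ<-const zero    x = refl
Σ<-const (suc k) x = trans (cong (ℤ._+_ (+ x)) (Σ<-const k x)) (≡.sym (ℤP.pos-+ x (k * x)))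

Σ<-neg : ∀ k h → Σ< k (λ i → - h i) ≡ - Σ< k h
Σ<-neg zero    h = refl
Σ<-neg (suc k) h = trans (cong (ℤ._+_ (- h 0)) (Σ<-neg k (λ i → h (suc i))))
                         (≡.sym (ℤP.neg-distrib-+ (h 0) _))

Σ<-minusOnes : ∀ k → Σ< k (λ _ → -1ℤ) ≡ - + k
Σ<-minusOnes k = trans (Σ<-neg k (λ _ → 1ℤ)) (cong -_ (Σ<-ones k))

Σ<-when : ∀ k b x → Σ< k (λ _ → when b x) ≡ when b (Σ< k (λ _ → x))
Σ<-when k true  x = refl
Σ<-when k false x = Σ<-zero k

Σ<-point : ∀ k t x → t < k → Σ< k (λ q → when (t ≡ᵇ q) x) ≡ x
Σ<-point (suc k) zero    x _         = trans (cong (ℤ._+_ x) (Σ<-zero k)) (ℤP.+-identityʳ x)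
Σ<-point (suc k) (suc t) x (s≤s t<k) = trans (ℤP.+-identityˡ _) (Σ<-point k t x t<k)

Σ<-allBut : ∀ k t → t < k → Σ< k (λ j → when (not (t ≡ᵇ j)) 1ℤ) ≡ + (k ∸ 1)
Σ<-allBut (suc k)       zero    _         = trans (ℤP.+-identityˡ _) (Σ<-ones k)
Σ<-allBut (suc (suc k)) (suc t) (s≤s t<k) = cong (ℤ._+_ 1ℤ) (Σ<-allBut (suc k) t t<k)

Σ<-oneBlock : ∀ k d t x h → t < k →
  (∀ q r → q < k → r < d → h (q * d + r) ≡ when (t ≡ᵇ q) x) →
  Σ< (k * d) h ≡ Σ< d (λ _ → x)
Σ<-oneBlock k d t x h t<k block = begin
  Σ< (k * d) h                                   ≡⟨ Σ<-blocks k d h ⟩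
  Σ< k (λ q → Σ< d (λ r → h (q * d + r)))        ≡⟨ Σ<-cong k (λ q q<k → Σ<-cong d (λ r → block q r q<k)) ⟩
  Σ< k (λ q → Σ< d (λ _ → when (t ≡ᵇ q) x))      ≡⟨ Σ<-cong k (λ q _ → Σ<-when d (t ≡ᵇ q) x) ⟩
  Σ< k (λ q → when (t ≡ᵇ q) (Σ< d (λ _ → x)))    ≡⟨ Σ<-point k t _ t<k ⟩
  Σ< d (λ _ → x)                                 ∎
  where open ≡-Reasoning

Σℤ-cong : ∀ n {g g′ : Fin n → ℤ} → (∀ i → g i ≡ g′ i) → Σℤ n g ≡ Σℤ n g′
Σℤ-cong zero    e = refl
Σℤ-cong (suc n) e = cong₂ ℤ._+_ (e Fin.zero) (Σℤ-cong n (λ i → e (Fin.suc i)))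

Σℤ-toℕ : ∀ n (h : ℕ → ℤ) → Σℤ n (λ w → h (toℕ w)) ≡ Σ< n h
Σℤ-toℕ zero    h = refl
Σℤ-toℕ (suc n) h = cong (ℤ._+_ (h 0)) (Σℤ-toℕ n (λ i → h (suc i)))

Σℤ≡sum : ∀ n (g : Fin n → ℤ) → Σℤ n g ≡ sum g
Σℤ≡sum zero    g = refl
Σℤ≡sum (suc n) g = cong (ℤ._+_ (g Fin.zero)) (Σℤ≡sum n (λ i → g (Fin.suc i)))

Σℤ²≡sum² : ∀ n (g : Fin n → Fin n → ℤ) → Σℤ n (λ u → Σℤ n (g u)) ≡ sum (λ u → sum (g u))
Σℤ²≡sum² n g = trans (Σℤ≡sum n _) (sum-cong-≗ (λ u → Σℤ≡sum n (g u)))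

upper : ∀ {n} → (Fin n → Fin n → ℤ) → Fin n → Fin n → ℤ
upper g u v = when (toℕ u <ᵇ toℕ v) (g u v)

upper+lower : ∀ {n} (g : Fin n → Fin n → ℤ) → (∀ u v → g u v ≡ g v u) → (∀ u → g u u ≡ 0ℤ) →
  ∀ u v → g u v ≡ upper g u v ℤ.+ upper g v u
upper+lower g g-sym g-diag u v with ℕP.<-cmp (toℕ u) (toℕ v)
... | tri< u<v _ _
  rewrite <⇒<ᵇ≡true u<v | ≥⇒<ᵇ≡false (ℕP.<⇒≤ u<v) = ≡.sym (ℤP.+-identityʳ (g u v))
... | tri> _ _ v<u
  rewrite ≥⇒<ᵇ≡false (ℕP.<⇒≤ v<u) | <⇒<ᵇ≡true v<u = trans (g-sym u v) (≡.sym (ℤP.+-identityˡ (g v u)))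
... | tri≈ _ u≡v _ with FinP.toℕ-injective u≡v
...   | refl rewrite ≥⇒<ᵇ≡false (ℕP.≤-refl {toℕ u}) = g-diag u

Σ²-symmetric : ∀ n (g : Fin n → Fin n → ℤ) → (∀ u v → g u v ≡ g v u) → (∀ u → g u u ≡ 0ℤ) →
  Σℤ n (λ u → Σℤ n (g u)) ≡ Σℤ n (λ u → Σℤ n (upper g u)) ℤ.+ Σℤ n (λ u → Σℤ n (upper g u))
Σ²-symmetric n g g-sym g-diag = begin
  Σℤ n (λ u → Σℤ n (g u))
    ≡⟨ Σℤ²≡sum² n g ⟩
  sum (λ u → sum (g u))
    ≡⟨ sum-cong-≗ (λ u → sum-cong-≗ (upper+lower g g-sym g-diag u)) ⟩
  sum (λ u → sum (λ v → U u v ℤ.+ U v u))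
    ≡⟨ sum-cong-≗ (λ u → ∑-distrib-+ (U u) (λ v → U v u)) ⟩
  sum (λ u → sum (U u) ℤ.+ sum (λ v → U v u))
    ≡⟨ ∑-distrib-+ (λ u → sum (U u)) _ ⟩
  sum (λ u → sum (U u)) ℤ.+ sum (λ u → sum (λ v → U v u))
    ≡⟨ cong (ℤ._+_ (sum (λ u → sum (U u)))) (∑-comm (λ u v → U v u)) ⟩
  sum (λ u → sum (U u)) ℤ.+ sum (λ v → sum (U v))
    ≡⟨ ≡.sym (cong₂ ℤ._+_ (Σℤ²≡sum² n U) (Σℤ²≡sum² n U)) ⟩
  Σℤ n (λ u → Σℤ n (U u)) ℤ.+ Σℤ n (λ u → Σℤ n (U u))
    ∎
  where
  open ≡-Reasoning
  U : Fin n → Fin n → ℤ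
  U = upper g

-- Handshake identity: summing the labels at every vertex counts each edge
-- twice, so Σ_v Σ_{e ∈ E(v)} f(e) = 2·w(f) for any symmetric labelling.
handshake : ∀ {n} (G : Graph n) (f : Labelling n) → (∀ u v → f u v ≡ f v u) →
  Σℤ n (sumAt G f) ≡ weight G f ℤ.+ weight G f
handshake {n} G f f-sym = Σ²-symmetric n (λ u v → onEdge G u v (f u v)) onEdge-sym onEdge-diag
  where
  onEdge-sym : ∀ u v → onEdge G u v (f u v) ≡ onEdge G v u (f v u)
  onEdge-sym u v = cong₂ when (Graph.sym G u v) (f-sym u v)
  onEdge-diag : ∀ u → onEdge G u u (f u u) ≡ 0ℤ
  onEdge-diag u = cong (λ b → when b (f u u)) (Graph.irrefl G u)

adj-sym : ∀ {n} (G : Graph n) {u v} → Adj G u v → Adj G v u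
adj-sym G {u} {v} e = trans (Graph.sym G v u) e

-- Connectivity criterion: if C is a clique and every vertex outside X equals
-- or is adjacent to a vertex of C outside X, then G − X is connected
-- (walk u → hub of u → hub of v → v).
cliqueHubs⇒connected : ∀ {n} (G : Graph n) (C : Fin n → Set) (X : Subset n) →
  (∀ h h′ → C h → C h′ → h ≢ h′ → Adj G h h′) →
  (∀ u → u ∉ X → Σ (Fin n) (λ h → C h × h ∉ X × (h ≡ u ⊎ Adj G u h))) →
  ConnectedAvoiding G X
cliqueHubs⇒connected {n} G C X clique hubOf u v u∉X v∉X
  with hubOf u u∉X | hubOf v v∉X
... | hu , C-hu , hu∉X , u~hu | hv , C-hv , hv∉X , v~hv = toHub u~hu (across (hu Fin.≟ hv))
  where
  fromHub : hv ≡ v ⊎ Adj G v hv → WalkAvoiding G X hv v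
  fromHub (inj₁ refl) = here hv∉X
  fromHub (inj₂ e)    = step hv∉X (adj-sym G e) (here v∉X)
  across : Dec (hu ≡ hv) → WalkAvoiding G X hu v
  across (yes refl) = fromHub v~hv
  across (no hu≢hv) = step hu∉X (clique hu hv C-hu C-hv hu≢hv) (fromHub v~hv)
  toHub : hu ≡ u ⊎ Adj G u hu → WalkAvoiding G X hu v → WalkAvoiding G X u v
  toHub (inj₁ refl) w = w
  toHub (inj₂ e)    w = step u∉X e w

missesInterval : ∀ {N} (X : Subset N) (lo k : ℕ) → lo + k ≤ N → ∣ X ∣ < k →
  Σ (Fin N) (λ i → lo ≤ toℕ i × toℕ i < lo + k × i ∉ X)
missesInterval X lo zero _ ()
missesInterval (b ∷ X) (suc lo) k (s≤s bound) small
  with missesInterval X lo k bound (ℕP.≤-<-trans (∣p∣≤∣x∷p∣ b X) small)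
... | i , lo≤i , i<hi , i∉X = Fin.suc i , s≤s lo≤i , s≤s i<hi , λ { (there i∈X) → i∉X i∈X }
missesInterval (outside ∷ X) zero (suc k) _ _ = Fin.zero , z≤n , s≤s z≤n , λ ()
missesInterval (inside ∷ X) zero (suc k) (s≤s bound) (s≤s small)
  with missesInterval X zero k bound small
... | i , _ , i<k , i∉X = Fin.suc i , z≤n , s≤s i<k , λ { (there i∈X) → i∉X i∈X }

scaledDifference≤ : ∀ k T P Q → k * T + Q ≤ k * P → + k ℤ.* (+ T ℤ.- + P) ℤ.≤ - + Q
scaledDifference≤ k T P Q le with ℕP.m≤n⇒∃[o]m+o≡n le
... | r , kT+Q+r≡kP = subst (ℤ._≤ - + Q) (≡.sym difference) (ℤP.i-j≤i (- + Q) (+ r))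
  where
  open ≡-Reasoning
  distrib : ∀ x y z → x ℤ.* (y ℤ.- z) ≡ x ℤ.* y ℤ.- x ℤ.* z
  distrib = solve-∀
  cancel : ∀ t q r → t ℤ.- (t ℤ.+ q ℤ.+ r) ≡ - q ℤ.- r
  cancel = solve-∀
  difference : + k ℤ.* (+ T ℤ.- + P) ≡ - + Q ℤ.- + r
  difference = begin
    + k ℤ.* (+ T ℤ.- + P)                 ≡⟨ distrib (+ k) (+ T) (+ P) ⟩
    + k ℤ.* + T ℤ.- + k ℤ.* + P           ≡⟨ cong₂ ℤ._-_ (≡.sym (ℤP.pos-* k T)) (≡.sym (ℤP.pos-* k P)) ⟩
    + (k * T) ℤ.- + (k * P)               ≡⟨ cong (λ z → + (k * T) ℤ.- + z) (≡.sym kT+Q+r≡kP) ⟩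
    + (k * T) ℤ.- + (k * T + Q + r)       ≡⟨ cong (λ z → + (k * T) ℤ.- z)
                                               (trans (ℤP.pos-+ (k * T + Q) r) (cong (ℤ._+ + r) (ℤP.pos-+ (k * T) Q))) ⟩
    + (k * T) ℤ.- (+ (k * T) ℤ.+ + Q ℤ.+ + r) ≡⟨ cancel (+ (k * T)) (+ Q) (+ r) ⟩
    - + Q ℤ.- + r                         ∎

-- The extremal graph for m = m' + 1 on n = 4m + 4c vertices: vertices i < a
-- form the core (group i / m), vertices a + j the pendants (group j / c).
module Construction (m′ : ℕ) where
  m c a n : ℕ
  m = suc m′
  c = m + m + m′
  a = 4 * m
  n = a + 4 * c

  isCore : ℕ → Bool
  isCore i = i <ᵇ a

  coreGroup pendantGroup : ℕ → ℕ
  coreGroup i    = i / m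
  pendantGroup j = (j ∸ a) / c

  link : Bool → Bool → ℕ → ℕ → Bool
  link true  true  i j = not (i ≡ᵇ j)
  link true  false i j = coreGroup i ≡ᵇ pendantGroup j
  link false true  i j = pendantGroup i ≡ᵇ coreGroup j
  link false false i j = false

  label : Bool → Bool → ℤ
  label true  true  = 1ℤ
  label true  false = -1ℤ
  label false _     = -1ℤ

  link-sym : ∀ x y i j → link x y i j ≡ link y x j i
  link-sym true  true  i j = cong not (≡ᵇ-sym i j)
  link-sym true  false i j = ≡ᵇ-sym (coreGroup i) (pendantGroup j)
  link-sym false true  i j = ≡ᵇ-sym (pendantGroup i) (coreGroup j)
  link-sym false false i j = refl

  link-irrefl : ∀ x i → link x x i i ≡ false
  link-irrefl true  i = cong not (≡ᵇ-refl i)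
  link-irrefl false i = refl

  label-sym : ∀ x y → label x y ≡ label y x
  label-sym true  true  = refl
  label-sym true  false = refl
  label-sym false true  = refl
  label-sym false false = refl

  label-sign : ∀ x y → IsSign (label x y)
  label-sign true  true  = inj₁ refl
  label-sign true  false = inj₂ refl
  label-sign false _     = inj₂ refl

  link⇒core : ∀ x y i j → link x y i j ≡ true → x ≡ true ⊎ y ≡ true
  link⇒core true  _     i j _ = inj₁ refl
  link⇒core false true  i j _ = inj₂ refl
  link⇒core false false i j ()

  adjℕ : ℕ → ℕ → Bool
  adjℕ i j = link (isCore i) (isCore j) i j

  G : Graph n
  G = record
    { adj    = λ u v → adjℕ (toℕ u) (toℕ v)
    ; sym    = λ u v → link-sym (isCore (toℕ u)) (isCore (toℕ v)) (toℕ u) (toℕ v)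
    ; irrefl = λ u → link-irrefl (isCore (toℕ u)) (toℕ u)
    }

  f : Labelling n
  f u v = label (isCore (toℕ u)) (isCore (toℕ v))

  H : ℕ → ℕ → ℤ
  H i j = when (adjℕ i j) (label (isCore i) (isCore j))

  H-kinds : ∀ i j {x y} → isCore i ≡ x → isCore j ≡ y → H i j ≡ when (link x y i j) (label x y)
  H-kinds i j refl refl = refl

  a≤a+ : ∀ j → a ≤ a + j
  a≤a+ j = ℕP.m≤m+n a j

  pendantGroup-at : ∀ q r → r < c → pendantGroup (a + (q * c + r)) ≡ q
  pendantGroup-at q r r<c = trans (cong (_/ c) (ℕP.m+n∸m≡n a (q * c + r))) ([q*d+r]/d≡q q r c r<c)

  pendantGroup<4 : ∀ {i} → a ≤ i → i < n → pendantGroup i < 4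
  pendantGroup<4 {i} a≤i i<n = m<n*o⇒m/o<n {i ∸ a} {4} {c}
    (ℕP.+-cancelˡ-< a _ _ (subst (_< n) (≡.sym (ℕP.m+[n∸m]≡n a≤i)) i<n))

  -- A core vertex sees a − 1 = c + m core neighbours (+1) and the c
  -- pendants of its group (−1).
  coreSum : ∀ {i} → i < a → Σ< n (H i) ≡ + m
  coreSum {i} i<a = begin
    Σ< n (H i)                                            ≡⟨ Σ<-split a (4 * c) (H i) ⟩
    Σ< a (H i) ℤ.+ Σ< (4 * c) (λ j → H i (a + j))         ≡⟨ cong₂ ℤ._+_ coreNeighbours pendantNeighbours ⟩
    + (c + m) ℤ.+ - + c                                   ≡⟨ cong (ℤ._+ - + c) (ℤP.pos-+ c m) ⟩
    + c ℤ.+ + m ℤ.+ - + c                                 ≡⟨ cancel (+ c) (+ m) ⟩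
    + m                                                   ∎
    where
    open ≡-Reasoning
    cancel : ∀ x y → x ℤ.+ y ℤ.+ - x ≡ y
    cancel = solve-∀
    -- a ∸ 1 unfolds to m′ + (m + (m + (m + 0))).
    core-degree : ∀ x → x + (suc x + (suc x + (suc x + 0))) ≡ suc x + suc x + x + suc x
    core-degree = ℕSolver.solve-∀
    a∸1≡c+m : a ∸ 1 ≡ c + m
    a∸1≡c+m = core-degree m′
    coreNeighbours : Σ< a (H i) ≡ + (c + m)
    coreNeighbours =
      trans (Σ<-cong a {h′ = λ j → when (not (i ≡ᵇ j)) 1ℤ}
                       (λ j j<a → H-kinds i j (<⇒<ᵇ≡true i<a) (<⇒<ᵇ≡true j<a)))
            (trans (Σ<-allBut a i i<a) (cong +_ a∸1≡c+m))
    pendantNeighbours : Σ< (4 * c) (λ j → H i (a + j)) ≡ - + c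
    pendantNeighbours =
      trans (Σ<-oneBlock 4 c (coreGroup i) -1ℤ (λ j → H i (a + j)) (m<n*o⇒m/o<n i<a) entry)
            (Σ<-minusOnes c)
      where
      entry : ∀ q r → q < 4 → r < c → H i (a + (q * c + r)) ≡ when (coreGroup i ≡ᵇ q) -1ℤ
      entry q r _ r<c = trans (H-kinds i (a + (q * c + r)) (<⇒<ᵇ≡true i<a) (≥⇒<ᵇ≡false (a≤a+ (q * c + r))))
                              (cong (λ g → when (coreGroup i ≡ᵇ g) -1ℤ) (pendantGroup-at q r r<c))

  -- A pendant vertex sees exactly the m core vertices of its group (−1).
  pendantSum : ∀ {i} → a ≤ i → i < n → Σ< n (H i) ≡ - + m
  pendantSum {i} a≤i i<n = begin
    Σ< n (H i)                                            ≡⟨ Σ<-split a (4 * c) (H i) ⟩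
    Σ< a (H i) ℤ.+ Σ< (4 * c) (λ j → H i (a + j))         ≡⟨ cong₂ ℤ._+_ coreNeighbours noPendants ⟩
    - + m ℤ.+ 0ℤ                                          ≡⟨ ℤP.+-identityʳ (- + m) ⟩
    - + m                                                 ∎
    where
    open ≡-Reasoning
    t : ℕ
    t = pendantGroup i
    entry : ∀ q r → q < 4 → r < m → H i (q * m + r) ≡ when (t ≡ᵇ q) -1ℤ
    entry q r q<4 r<m = trans (H-kinds i (q * m + r) (≥⇒<ᵇ≡false a≤i) (<⇒<ᵇ≡true ([q*d+r]<k*d q<4 r<m)))
                              (cong (λ g → when (t ≡ᵇ g) -1ℤ) ([q*d+r]/d≡q q r m r<m))
    coreNeighbours : Σ< a (H i) ≡ - + m
    coreNeighbours = trans (Σ<-oneBlock 4 m t -1ℤ (H i) (pendantGroup<4 a≤i i<n) entry) (Σ<-minusOnes m)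
    noPendants : Σ< (4 * c) (λ j → H i (a + j)) ≡ 0ℤ
    noPendants = trans (Σ<-cong (4 * c) {h′ = λ _ → 0ℤ}
                         (λ j _ → H-kinds i (a + j) (≥⇒<ᵇ≡false a≤i) (≥⇒<ᵇ≡false (a≤a+ j))))
                       (Σ<-zero (4 * c))

  σ : Bool → ℤ
  σ true  = + m
  σ false = - + m

  sumAt-value : ∀ u → sumAt G f u ≡ σ (isCore (toℕ u))
  sumAt-value u = trans (Σℤ-toℕ n (H (toℕ u))) (labelSum (toℕ u) (FinP.toℕ<n u))
    where
    labelSum : ∀ i → i < n → Σ< n (H i) ≡ σ (isCore i)
    labelSum i i<n with i ℕ.<? a
    ... | yes i<a = trans (coreSum i<a) (cong σ (≡.sym (<⇒<ᵇ≡true i<a)))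
    ... | no  i≮a = trans (pendantSum a≤i i<n) (cong σ (≡.sym (≥⇒<ᵇ≡false a≤i)))
      where
      a≤i : a ≤ i
      a≤i = ℕP.≮⇒≥ i≮a

  -- Closed-neighbourhood sums: 2m − 1 on core–core edges, 1 on core–pendant edges.
  closedSum-positive : ∀ x y → x ≡ true ⊎ y ≡ true → 1ℤ ℤ.≤ (σ x ℤ.+ σ y) ℤ.- label x y
  closedSum-positive true  true  _ = ℤ.+≤+ (ℕP.≤-trans (s≤s z≤n) (ℕP.m≤n+m m m′))
  closedSum-positive true  false _ = ℤP.≤-reflexive (cong (ℤ._- -1ℤ) (≡.sym (ℤP.+-inverseʳ (+ m))))
  closedSum-positive false true  _ = ℤP.≤-reflexive (cong (ℤ._- -1ℤ) (≡.sym (ℤP.+-inverseˡ (+ m))))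
  closedSum-positive false false (inj₁ ())
  closedSum-positive false false (inj₂ ())

  dominates : ∀ u v → Adj G u v → 1ℤ ℤ.≤ closedSum G f u v
  dominates u v uv = subst (1ℤ ℤ.≤_)
    (≡.sym (cong₂ (λ s t → (s ℤ.+ t) ℤ.- f u v) (sumAt-value u) (sumAt-value v)))
    (closedSum-positive (isCore (toℕ u)) (isCore (toℕ v)) (link⇒core _ _ (toℕ u) (toℕ v) uv))

  f-sym : ∀ u v → f u v ≡ f v u
  f-sym u v = label-sym (isCore (toℕ u)) (isCore (toℕ v))

  sedf : IsSEDF G f
  sedf = record
    { symmetric = f-sym
    ; signs     = λ u v _ → label-sign (isCore (toℕ u)) (isCore (toℕ v))
    ; dominates = dominates
    }

  -- a core vertices with label sum m and 4c pendants with label sum −m.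
  labelTotal : Σℤ n (sumAt G f) ≡ + (a * m) ℤ.- + (4 * c * m)
  labelTotal = begin
    Σℤ n (sumAt G f)                                       ≡⟨ Σℤ-cong n sumAt-value ⟩
    Σℤ n (λ u → σ (isCore (toℕ u)))                        ≡⟨ Σℤ-toℕ n (λ i → σ (isCore i)) ⟩
    Σ< n (λ i → σ (isCore i))                              ≡⟨ Σ<-split a (4 * c) (λ i → σ (isCore i)) ⟩
    Σ< a (λ i → σ (isCore i)) ℤ.+ Σ< (4 * c) (λ j → σ (isCore (a + j)))
      ≡⟨ cong₂ ℤ._+_ (Σ<-cong a (λ i i<a → cong σ (<⇒<ᵇ≡true i<a)))
                     (Σ<-cong (4 * c) (λ j _ → cong σ (≥⇒<ᵇ≡false (a≤a+ j)))) ⟩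
    Σ< a (λ _ → + m) ℤ.+ Σ< (4 * c) (λ _ → - + m)
      ≡⟨ cong₂ ℤ._+_ (Σ<-const a m) (trans (Σ<-neg (4 * c) (λ _ → + m)) (cong -_ (Σ<-const (4 * c) m))) ⟩
    + (a * m) ℤ.- + (4 * c * m)                            ∎
    where open ≡-Reasoning

  -- 6·w(f) ≤ −m·n: by the handshake identity 6·w(f) = 3·(am − 4cm), and
  -- 3·4cm = 3am + mn + 8m′m.
  weight-bound : + 6 ℤ.* weight G f ℤ.≤ - + (m * n)
  weight-bound = subst (ℤ._≤ - + (m * n)) (≡.sym sixfold)
                       (scaledDifference≤ 3 (a * m) (4 * c * m) (m * n) sizes)
    where
    triple : ∀ w → + 6 ℤ.* w ≡ + 3 ℤ.* (w ℤ.+ w)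
    triple = solve-∀
    sixfold : + 6 ℤ.* weight G f ≡ + 3 ℤ.* (+ (a * m) ℤ.- + (4 * c * m))
    sixfold = trans (triple (weight G f))
                    (cong (ℤ._*_ (+ 3)) (trans (≡.sym (handshake G f f-sym)) labelTotal))
    identity : ∀ x → 3 * (4 * (suc x + suc x + x) * suc x)
                   ≡ 3 * (4 * suc x * suc x) + suc x * (4 * suc x + 4 * (suc x + suc x + x)) + 8 * x * suc x
    identity = ℕSolver.solve-∀
    sizes : 3 * (a * m) + m * n ≤ 3 * (4 * c * m)
    sizes = subst (3 * (a * m) + m * n ≤_) (≡.sym (identity m′)) (ℕP.m≤m+n _ _)

  -- Connectivity: the core is a clique of hubs.
  Core : Fin n → Set
  Core h = toℕ h < a

  core-clique : ∀ h h′ → Core h → Core h′ → h ≢ h′ → Adj G h h′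
  core-clique h h′ h<a h′<a h≢h′ =
    trans (cong₂ (λ x y → link x y (toℕ h) (toℕ h′)) (<⇒<ᵇ≡true h<a) (<⇒<ᵇ≡true h′<a)) distinct
    where
    distinct : not (toℕ h ≡ᵇ toℕ h′) ≡ true
    distinct with toℕ h ≡ᵇ toℕ h′ in eq
    ... | true  = ⊥-elim (h≢h′ (FinP.toℕ-injective (ℕP.≡ᵇ⇒≡ _ _ (subst T (≡.sym eq) _))))
    ... | false = refl

  groupInCore : ∀ {t} → t < 4 → t * m + m ≤ a
  groupInCore {t} t<4 = ℕP.≤-trans (ℕP.≤-reflexive (ℕP.+-comm (t * m) m)) (ℕP.*-monoˡ-≤ m t<4)

  -- A pendant keeps a core neighbour after deleting fewer than m vertices:
  -- its group has m core vertices, not all deleted.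
  pendantHub : ∀ X → ∣ X ∣ < m → ∀ u → a ≤ toℕ u → Σ (Fin n) (λ h → Core h × h ∉ X × Adj G u h)
  pendantHub X small u a≤u = hubIn (missesInterval X (t * m) m (ℕP.≤-trans group⊆core (a≤a+ (4 * c))) small)
    where
    t : ℕ
    t = pendantGroup (toℕ u)
    group⊆core : t * m + m ≤ a
    group⊆core = groupInCore (pendantGroup<4 a≤u (FinP.toℕ<n u))
    hubIn : Σ (Fin n) (λ i → t * m ≤ toℕ i × toℕ i < t * m + m × i ∉ X) →
            Σ (Fin n) (λ h → Core h × h ∉ X × Adj G u h)
    hubIn (h , lo≤h , h<hi , h∉X) = h , h<a , h∉X , adjacent
      where
      h<a : toℕ h < a
      h<a = ℕP.<-≤-trans h<hi group⊆core
      adjacent : Adj G u h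
      adjacent = trans (cong₂ (λ x y → link x y (toℕ u) (toℕ h)) (≥⇒<ᵇ≡false a≤u) (<⇒<ᵇ≡true h<a))
                       (trans (cong (t ≡ᵇ_) (inBlock t m (toℕ h) lo≤h h<hi)) (≡ᵇ-refl t))

  hubOf : ∀ X → ∣ X ∣ < m → ∀ u → u ∉ X → Σ (Fin n) (λ h → Core h × h ∉ X × (h ≡ u ⊎ Adj G u h))
  hubOf X small u u∉X with toℕ u ℕ.<? a
  ... | yes u<a = u , u<a , u∉X , inj₁ refl
  ... | no  u≮a with pendantHub X small u (ℕP.≮⇒≥ u≮a)
  ...   | h , h<a , h∉X , uh = h , h<a , h∉X , inj₂ uh

  connected : KConnected m G
  connected = ℕP.≤-trans (ℕP.m<m+n m (s≤s z≤n)) (a≤a+ (4 * c))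
            , λ X small → cliqueHubs⇒connected G Core X core-clique (hubOf X small)

mainTheorem1 : (m : ℕ) → 1 ≤ m →
    Σ ℕ (λ n → Σ (Graph n) (λ G → KConnected m G ×
      Σ (Labelling n) (λ f → IsSEDF G f ×
        ((+ 6) ℤ.* weight G f ℤ.≤ - (+ (m * n))))))
mainTheorem1 (suc m′) (s≤s z≤n) = n , G , connected , f , sedf , weight-bound
  where open Construction m′
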